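{- Let $G$ be a $3$-partite graph with vertex partition $X,Y,Z$ such that for every $x\in X$, $N(x)\cap Y\neq\emptyset$ and $N(x)\cap Z\neq\emptyset$. (i) If $G$ contains no $C_4^{\text{multi}}$, then $e(G)\le |Y||Z|+2|X|$. (ii) If $G$ contains neither a triangle $C_3$ nor a $C_4^{\text{multi}}$, then $e(G)\le |Y||Z|+|X|$.
   Context: $N(x)$ denotes the neighborhood of $x$ in $G$ and $e(G)$ the number of edges. $C_4^{\text{multi}}$ denotes a multipartite $4$-cycle in the $3$-partite graph, i.e. a cycle of length $4$ containing at least one vertex in each of the three parts $X,Y,Z$. -}

module Defs where

open import Data.Nat using (ℕ; zero; suc; _+_; _*_; _<ᵇ_)
open import Data.Bool using (Bool; true; false; _∧_)
open import Data.Fin using (Fin; zero; suc; toℕ; _≟_)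
open import Relation.Nullary using (does)
open import Data.Product using (Σ; _×_; ∃-syntax)
open import Data.Sum using (_⊎_)
open import Relation.Binary.PropositionalEquality using (_≡_; _≢_)

record Graph (n : ℕ) : Set where
  field
    adj     : Fin n → Fin n → Bool
    sym     : ∀ u v → adj u v ≡ adj v u
    irrefl  : ∀ u → adj u u ≡ false
open Graph public

Σ< : (n : ℕ) → (Fin n → ℕ) → ℕ
Σ< zero    f = 0
Σ< (suc n) f = f zero + Σ< n (λ i → f (suc i))

b2n : Bool → ℕ
b2n true  = 1
b2n false = 0

e : ∀ {n} → Graph n → ℕ
e {n} G = Σ< n (λ i → Σ< n (λ j → b2n ((toℕ i <ᵇ toℕ j) ∧ adj G i j)))

pX pY pZ : Fin 3
pX = zero
pY = suc zero
pZ = suc (suc zero)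

IsTripartite : ∀ {n} → Graph n → (Fin n → Fin 3) → Set
IsTripartite G part = ∀ u v → adj G u v ≡ true → part u ≢ part v

partSize : ∀ {n} → (Fin n → Fin 3) → Fin 3 → ℕ
partSize {n} part p = Σ< n (λ v → b2n (does (part v ≟ p)))

HasNbrIn : ∀ {n} → Graph n → (Fin n → Fin 3) → Fin n → Fin 3 → Set
HasNbrIn G part x p = ∃[ y ] (part y ≡ p × adj G x y ≡ true)

IsC4 : ∀ {n} → Graph n → Fin n → Fin n → Fin n → Fin n → Set
IsC4 G a b c d =
  (a ≢ b × a ≢ c × a ≢ d × b ≢ c × b ≢ d × c ≢ d) ×
  (adj G a b ≡ true × adj G b c ≡ true × adj G c d ≡ true × adj G d a ≡ true)

HasC4multi : ∀ {n} → Graph n → (Fin n → Fin 3) → Set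
HasC4multi G part = ∃[ a ] ∃[ b ] ∃[ c ] ∃[ d ]
  (IsC4 G a b c d ×
   (∀ p → part a ≡ p ⊎ part b ≡ p ⊎ part c ≡ p ⊎ part d ≡ p))

HasTriangle : ∀ {n} → Graph n → Set
HasTriangle G = ∃[ a ] ∃[ b ] ∃[ c ]
  ((a ≢ b × a ≢ c × b ≢ c) ×
   (adj G a b ≡ true × adj G b c ≡ true × adj G c a ≡ true))

module Submission where

-- For x ∈ X let a and b be its numbers of neighbours in Y and in Z, and t the number of edges
-- between these two neighbourhoods. Orienting every edge X → Y, X → Z or Y → Z gives
-- e(G) = Σ a + Σ b + e(Y,Z), summing over x ∈ X. Without a multipartite C4, two vertices in
-- distinct parts have at most one common neighbour in the third part. Applied to (y,z) ∈ Y × Z this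
-- makes the sets N_Y(x) × N_Z(x) pairwise disjoint, and a pair in one of them that is an edge closes
-- a triangle, so e(Y,Z) + Σ ab ≤ |Y||Z| + Σ t. Applied to (x,y) and (x,z) it gives t ≤ min(a,b),
-- and t = 0 if G is triangle-free. Since a, b ≥ 1 this yields a + b + t ≤ ab + 2 (respectively
-- ab + 1), and summing over X proves both bounds.

open import Defs hiding (sym)
open import Data.Bool using (Bool; true; false; _∧_)
open import Data.Empty using (⊥; ⊥-elim)
open import Data.Fin using (Fin; zero; suc; toℕ; _≟_)
open import Data.Fin.Properties using (suc-injective; toℕ-injective; all?)
open import Data.Nat using (ℕ; zero; suc; _+_; _*_; _≤_; _<ᵇ_; z≤n; s≤s)
open import Data.Nat.Properties
  using (+-*-semiring; *-commutativeSemigroup; module ≤-Reasoning;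
         ≤-trans; ≤-reflexive; +-mono-≤; +-monoʳ-≤; *-monoʳ-≤; +-cancelʳ-≤; m≤m+n; m≤n+m; m≤m*n;
         +-identityʳ; *-identityʳ; *-zeroʳ; *-comm; *-assoc; *-distribˡ-+; *-distribʳ-+; *-cancelˡ-≡)
  renaming (_≟_ to _≟ℕ_)
open import Data.Nat.Tactic.RingSolver using (solve-∀)
open import Data.Product using (_×_; _,_; proj₁; proj₂)
open import Data.Sum using (_⊎_; inj₁; map₂)
open import Function using (_∘_)
open import Relation.Binary.PropositionalEquality
  using (_≡_; _≢_; refl; sym; trans; cong; cong₂; subst; subst₂; module ≡-Reasoning)
open import Relation.Nullary using (¬_; Dec; does; yes; no)
open import Relation.Nullary.Decidable using (from-yes; ¬?; _→-dec_; _⊎-dec_; dec-true)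
open import Algebra.Properties.Semiring.Sum +-*-semiring
  using (sum; sum-syntax; ∑-comm; ∑-distrib-+; *-distribˡ-sum; *-distribʳ-sum; sum-cong-≗)
open import Algebra.Properties.CommutativeSemigroup *-commutativeSemigroup using (x∙yz≈y∙xz)

Σ<≡sum : ∀ n (f : Fin n → ℕ) → Σ< n f ≡ sum f
Σ<≡sum zero    f = refl
Σ<≡sum (suc n) f = cong (f zero +_) (Σ<≡sum n (f ∘ suc))

sum-mono-≤ : ∀ {n} {f g : Fin n → ℕ} → (∀ i → f i ≤ g i) → sum f ≤ sum g
sum-mono-≤ {zero}  f≤g = z≤n
sum-mono-≤ {suc n} f≤g = +-mono-≤ (f≤g zero) (sum-mono-≤ (f≤g ∘ suc))

term≤sum : ∀ {n} (f : Fin n → ℕ) i → f i ≤ sum f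
term≤sum f zero    = m≤m+n _ _
term≤sum f (suc i) = ≤-trans (term≤sum (f ∘ suc) i) (m≤n+m _ _)

count≡0 : ∀ {n} (P : Fin n → Bool) → (∀ i → P i ≡ false) → sum (b2n ∘ P) ≡ 0
count≡0 {zero}  P none = refl
count≡0 {suc n} P none rewrite none zero = count≡0 (P ∘ suc) (none ∘ suc)

count≤1 : ∀ {n} (P : Fin n → Bool) →
  (∀ {i j} → P i ≡ true → P j ≡ true → i ≡ j) → sum (b2n ∘ P) ≤ 1
count≤1 {zero}  P unique = z≤n
count≤1 {suc n} P unique with P zero in P0
... | false = count≤1 (P ∘ suc) (λ Pi Pj → suc-injective (unique Pi Pj))
... | true  = ≤-reflexive (cong suc (count≡0 (P ∘ suc) none))
  where
  none : ∀ i → P (suc i) ≡ false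
  none i with P (suc i) in Pi
  ... | false = refl
  ... | true with () ← unique P0 Pi

∑∑-distrib-+ : ∀ {n} (f g : Fin n → Fin n → ℕ) →
  ∑[ i < n ] ∑[ j < n ] (f i j + g i j) ≡ ∑[ i < n ] ∑[ j < n ] f i j + ∑[ i < n ] ∑[ j < n ] g i j
∑∑-distrib-+ f g =
  trans (sum-cong-≗ (λ i → ∑-distrib-+ (f i) (g i))) (∑-distrib-+ (λ i → sum (f i)) (λ i → sum (g i)))

∑∑-cong-symmetric : ∀ {n} (s t : Fin n → Fin n → ℕ) →
  (∀ i j → s i j + s j i ≡ t i j + t j i) →
  ∑[ i < n ] ∑[ j < n ] s i j ≡ ∑[ i < n ] ∑[ j < n ] t i j
∑∑-cong-symmetric {n} s t s≈t = *-cancelˡ-≡ _ _ 2 (begin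
  2 * ∑∑ s                                ≡⟨ twice s ⟩
  ∑[ i < n ] ∑[ j < n ] (s i j + s j i)   ≡⟨ sum-cong-≗ (λ i → sum-cong-≗ (s≈t i)) ⟩
  ∑[ i < n ] ∑[ j < n ] (t i j + t j i)   ≡⟨ twice t ⟨
  2 * ∑∑ t                                ∎)
  where
  open ≡-Reasoning
  ∑∑ : (Fin n → Fin n → ℕ) → ℕ
  ∑∑ f = ∑[ i < n ] ∑[ j < n ] f i j
  twice : ∀ f → 2 * ∑∑ f ≡ ∑[ i < n ] ∑[ j < n ] (f i j + f j i)
  twice f = begin
    2 * ∑∑ f                                              ≡⟨ cong (∑∑ f +_) (+-identityʳ (∑∑ f)) ⟩
    ∑∑ f + ∑∑ f                                           ≡⟨ cong (∑∑ f +_) (∑-comm (λ i j → f j i)) ⟨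
    ∑∑ f + ∑[ i < n ] ∑[ j < n ] f j i                    ≡⟨ ∑∑-distrib-+ f (λ i j → f j i) ⟨
    ∑[ i < n ] ∑[ j < n ] (f i j + f j i)                 ∎

b2n-∧ : ∀ x y → b2n (x ∧ y) ≡ b2n x * b2n y
b2n-∧ true  y = sym (+-identityʳ (b2n y))
b2n-∧ false y = refl

∧-≡true : ∀ x {y} → x ∧ y ≡ true → x ≡ true × y ≡ true
∧-≡true true {true} _ = refl , refl

does≡true : ∀ {a} {A : Set a} (a? : Dec A) → does a? ≡ true → A
does≡true (yes a) _ = a

b2n³≡0 : ∀ x y z → (x ≡ true → y ≡ true → z ≡ true → ⊥) → b2n x * b2n y * b2n z ≡ 0
b2n³≡0 true  true  true  ¬xyz = ⊥-elim (¬xyz refl refl refl)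
b2n³≡0 true  true  false _    = refl
b2n³≡0 true  false z     _    = refl
b2n³≡0 false y     z     _    = refl

b2n+≤1+* : ∀ x {c} → c ≤ 1 → b2n x + c ≤ 1 + c * b2n x
b2n+≤1+* true  {c} _   = ≤-reflexive (cong suc (sym (*-identityʳ c)))
b2n+≤1+* false {c} c≤1 = ≤-trans c≤1 (m≤m+n 1 _)

m+n≤m*n+1 : ∀ {m n} → 1 ≤ m → 1 ≤ n → m + n ≤ m * n + 1
m+n≤m*n+1 {suc p} {suc q} _ _ =
  subst (suc p + suc q ≤_) (sym (identity p q)) (m≤m+n (suc p + suc q) (p * q))
  where
  identity : ∀ p q → suc p * suc q + 1 ≡ suc p + suc q + p * q
  identity = solve-∀

m+n+o≤m*n+2 : ∀ {m n o} → 1 ≤ m → 1 ≤ n → o ≤ m → o ≤ n → m + n + o ≤ m * n + 2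
m+n+o≤m*n+2 {suc p} {suc q} {o} _ _ o≤m o≤n =
  subst (suc p + suc q + o ≤_) (sym (identity p q)) (+-monoʳ-≤ (suc p + suc q) (o≤1+pq p q o≤m o≤n))
  where
  identity : ∀ p q → suc p * suc q + 2 ≡ suc p + suc q + (1 + p * q)
  identity = solve-∀
  o≤1+pq : ∀ p q → o ≤ suc p → o ≤ suc q → o ≤ 1 + p * q
  o≤1+pq zero    q       o≤1 _   = o≤1
  o≤1+pq (suc p) zero    _   o≤1 = subst (λ k → o ≤ 1 + k) (sym (*-zeroʳ p)) o≤1
  o≤1+pq (suc p) (suc q) o≤m _   = ≤-trans o≤m (s≤s (m≤m*n (suc p) (suc q)))

+-≤-combine : ∀ {s x y z p m} → x + p ≤ y + m → s + m ≤ p + z → s + x ≤ y + z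
+-≤-combine {s} {x} {y} {z} {p} {m} h₁ h₂ =
  +-cancelʳ-≤ (p + m) (s + x) (y + z) (subst₂ _≤_ (lhs s x p m) (rhs y z p m) (+-mono-≤ h₂ h₁))
  where
  lhs : ∀ s x p m → s + m + (x + p) ≡ s + x + (p + m)
  lhs = solve-∀
  rhs : ∀ y z p m → p + z + (y + m) ≡ y + z + (p + m)
  rhs = solve-∀

<ᵇ-either : ∀ {m n} → m ≢ n → b2n (m <ᵇ n) + b2n (n <ᵇ m) ≡ 1
<ᵇ-either {zero}  {zero}  m≢n = ⊥-elim (m≢n refl)
<ᵇ-either {zero}  {suc n} _   = refl
<ᵇ-either {suc m} {zero}  _   = refl
<ᵇ-either {suc m} {suc n} m≢n = <ᵇ-either (m≢n ∘ cong suc)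

*b2n-self : ∀ x {k} → (x ≡ true → k ≡ 1) → k * b2n x ≡ b2n x
*b2n-self true  k≡1 = cong (_* 1) (k≡1 refl)
*b2n-self false {k} _ = *-zeroʳ k

distinct-parts-cover : ∀ (a b c : Fin 3) → a ≢ b → a ≢ c → b ≢ c → ∀ p → a ≡ p ⊎ b ≡ p ⊎ c ≡ p
distinct-parts-cover = from-yes (all? λ (a : Fin 3) → all? λ (b : Fin 3) → all? λ (c : Fin 3) →
  ¬? (a ≟ b) →-dec ¬? (a ≟ c) →-dec ¬? (b ≟ c) →-dec
  all? λ (p : Fin 3) → (a ≟ p) ⊎-dec (b ≟ p) ⊎-dec (c ≟ p))

δ : Fin 3 → Fin 3 → ℕ
δ P p = b2n (does (P ≟ p))

partOrder : Fin 3 → Fin 3 → ℕ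
partOrder P Q = δ P pX * δ Q pY + δ P pX * δ Q pZ + δ P pY * δ Q pZ

partOrder-total : ∀ P Q → P ≢ Q → partOrder P Q + partOrder Q P ≡ 1
partOrder-total = from-yes (all? λ (P : Fin 3) → all? λ (Q : Fin 3) →
  ¬? (P ≟ Q) →-dec (partOrder P Q + partOrder Q P ≟ℕ 1))

module _ {n} (G : Graph n) where

  A : Fin n → Fin n → ℕ
  A u v = b2n (adj G u v)

  A-sym : ∀ u v → A u v ≡ A v u
  A-sym u v = cong b2n (Graph.sym G u v)

  adj-sym : ∀ {u v} → adj G u v ≡ true → adj G v u ≡ true
  adj-sym {u} {v} uv = trans (Graph.sym G v u) uv

  adj⇒≢ : ∀ {u v} → adj G u v ≡ true → u ≢ v
  adj⇒≢ {u} uu refl with () ← trans (sym uu) (irrefl G u)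

  oriented-pair≡A : ∀ (o : Fin n → Fin n → ℕ) {u v} → (adj G u v ≡ true → o u v + o v u ≡ 1) →
    o u v * A u v + o v u * A v u ≡ A u v
  oriented-pair≡A o {u} {v} total = begin
    o u v * A u v + o v u * A v u  ≡⟨ cong (λ a → o u v * A u v + o v u * a) (A-sym v u) ⟩
    o u v * A u v + o v u * A u v  ≡⟨ *-distribʳ-+ (A u v) (o u v) (o v u) ⟨
    (o u v + o v u) * A u v        ≡⟨ *b2n-self (adj G u v) total ⟩
    A u v                          ∎
    where open ≡-Reasoning

  e≡∑∑-oriented : (o : Fin n → Fin n → ℕ) → (∀ u v → adj G u v ≡ true → o u v + o v u ≡ 1) →
    e G ≡ ∑[ u < n ] ∑[ v < n ] (o u v * A u v)
  e≡∑∑-oriented o o-total = begin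
    e G
      ≡⟨ trans (Σ<≡sum n _) (sum-cong-≗ (λ u → Σ<≡sum n (t u))) ⟩
    ∑[ u < n ] ∑[ v < n ] t u v
      ≡⟨ sum-cong-≗ (λ u → sum-cong-≗ (λ v → b2n-∧ _ (adj G u v))) ⟩
    ∑[ u < n ] ∑[ v < n ] (index-order u v * A u v)
      ≡⟨ ∑∑-cong-symmetric _ _ (λ u v → trans (oriented-pair≡A index-order index-order-total)
                                              (sym (oriented-pair≡A o (o-total u v)))) ⟩
    ∑[ u < n ] ∑[ v < n ] (o u v * A u v) ∎
    where
    open ≡-Reasoning
    t index-order : Fin n → Fin n → ℕ
    t u v = b2n ((toℕ u <ᵇ toℕ v) ∧ adj G u v)
    index-order u v = b2n (toℕ u <ᵇ toℕ v)
    index-order-total : ∀ {u v} → adj G u v ≡ true → index-order u v + index-order v u ≡ 1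
    index-order-total uv = <ᵇ-either (adj⇒≢ uv ∘ toℕ-injective)

module PartSums {n} (part : Fin n → Fin 3) where

  χ : Fin 3 → Fin n → ℕ
  χ p v = δ (part v) p

  sumOver : Fin 3 → (Fin n → ℕ) → ℕ
  sumOver p f = ∑[ v < n ] (χ p v * f v)

  syntax sumOver p (λ v → t) = ∑[ v ∈ p ] t

  sumOver-cong : ∀ {p} {f g : Fin n → ℕ} → (∀ v → f v ≡ g v) → sumOver p f ≡ sumOver p g
  sumOver-cong {p} f≡g = sum-cong-≗ (λ v → cong (χ p v *_) (f≡g v))

  sumOver-mono : ∀ {p} {f g : Fin n → ℕ} → (∀ v → part v ≡ p → f v ≤ g v) → sumOver p f ≤ sumOver p g
  sumOver-mono {p} {f} {g} f≤g = sum-mono-≤ weighted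
    where
    weighted : ∀ v → χ p v * f v ≤ χ p v * g v
    weighted v with part v ≟ p
    ... | yes pv = *-monoʳ-≤ 1 (f≤g v pv)
    ... | no  _  = z≤n

  sumOver-+ : ∀ {p} (f g : Fin n → ℕ) → sumOver p (λ v → f v + g v) ≡ sumOver p f + sumOver p g
  sumOver-+ {p} f g = trans (sum-cong-≗ (λ v → *-distribˡ-+ (χ p v) (f v) (g v)))
                            (∑-distrib-+ (λ v → χ p v * f v) (λ v → χ p v * g v))

  sumOver-*ˡ : ∀ {p} c (f : Fin n → ℕ) → sumOver p (λ v → c * f v) ≡ c * sumOver p f
  sumOver-*ˡ {p} c f = trans (sum-cong-≗ (λ v → x∙yz≈y∙xz (χ p v) c (f v)))
                             (sym (*-distribˡ-sum c (λ v → χ p v * f v)))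

  sumOver-*ʳ : ∀ {p} c (f : Fin n → ℕ) → sumOver p (λ v → f v * c) ≡ sumOver p f * c
  sumOver-*ʳ {p} c f = trans (sumOver-cong (λ v → *-comm (f v) c)) (trans (sumOver-*ˡ c f) (*-comm c _))

  sumOver-const : ∀ p c → sumOver p (λ _ → c) ≡ partSize part p * c
  sumOver-const p c = begin
    ∑[ v < n ] (χ p v * c)  ≡⟨ *-distribʳ-sum c (χ p) ⟨
    sum (χ p) * c           ≡⟨ cong (_* c) (Σ<≡sum n (χ p)) ⟨
    partSize part p * c     ∎
    where open ≡-Reasoning

  sumOver-nested : ∀ {p q} (F : Fin n → Fin n → ℕ) →
    sumOver p (λ u → sumOver q (F u)) ≡ ∑[ u < n ] ∑[ v < n ] (χ p u * (χ q v * F u v))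
  sumOver-nested {p} {q} F = sum-cong-≗ (λ u → *-distribˡ-sum (χ p u) (λ v → χ q v * F u v))

  sumOver-comm : ∀ {p q} (F : Fin n → Fin n → ℕ) →
    sumOver p (λ u → sumOver q (F u)) ≡ sumOver q (λ v → sumOver p (λ u → F u v))
  sumOver-comm {p} {q} F = begin
    sumOver p (λ u → sumOver q (F u))                        ≡⟨ sumOver-nested F ⟩
    ∑[ u < n ] ∑[ v < n ] (χ p u * (χ q v * F u v))          ≡⟨ sum-cong-≗ (λ u → sum-cong-≗ (λ v →
                                                                  x∙yz≈y∙xz (χ p u) (χ q v) (F u v))) ⟩
    ∑[ u < n ] ∑[ v < n ] (χ q v * (χ p u * F u v))          ≡⟨ ∑-comm (λ u v → χ q v * (χ p u * F u v)) ⟩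
    ∑[ v < n ] ∑[ u < n ] (χ q v * (χ p u * F u v))          ≡⟨ sumOver-nested (λ v u → F u v) ⟨
    sumOver q (λ v → sumOver p (λ u → F u v))                ∎
    where open ≡-Reasoning

  sumOver-rotate : ∀ {p q r} (F : Fin n → Fin n → Fin n → ℕ) →
    sumOver p (λ u → sumOver q (λ v → sumOver r (F u v))) ≡
    sumOver r (λ w → sumOver p (λ u → sumOver q (λ v → F u v w)))
  sumOver-rotate F = trans (sumOver-cong (λ u → sumOver-comm (F u))) (sumOver-comm _)

  sumOver-weighted-≤ : ∀ {p} (f g : Fin n → ℕ) → (∀ v → part v ≡ p → g v ≤ 1) →
    sumOver p (λ v → f v * g v) ≤ sumOver p f
  sumOver-weighted-≤ f g g≤1 = ≤-trans (sumOver-mono (λ v pv → *-monoʳ-≤ (f v) (g≤1 v pv)))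
                                       (≤-reflexive (sumOver-cong (λ v → *-identityʳ (f v))))

  part-≢ : ∀ {u P Q} → part u ≡ P → P ≢ Q → part u ≢ Q
  part-≢ refl P≢Q = P≢Q

  parts-≢ : ∀ {u v P Q} → part u ≡ P → part v ≡ Q → P ≢ Q → part u ≢ part v
  parts-≢ refl refl P≢Q = P≢Q

module Tripartite {n} (G : Graph n) (part : Fin n → Fin 3) where

  open PartSums part public

  deg : Fin 3 → Fin n → ℕ
  deg p u = ∑[ v ∈ p ] A G u v

  common : Fin 3 → Fin n → Fin n → ℕ
  common p u v = ∑[ w ∈ p ] (A G u w * A G w v)

  triangles : Fin n → ℕ
  triangles x = ∑[ y ∈ pY ] ∑[ z ∈ pZ ] (A G x y * A G x z * A G y z)

  deg≥1 : ∀ {p u} → HasNbrIn G part u p → 1 ≤ deg p u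
  deg≥1 {p} {u} (v , pv , uv) = subst (_≤ deg p u) unit (term≤sum (λ w → χ p w * A G u w) v)
    where
    unit : χ p v * A G u v ≡ 1
    unit = cong₂ (λ a b → b2n a * b2n b) (dec-true (part v ≟ p) pv) uv

  e≡sumOver-deg : IsTripartite G part →
    e G ≡ ∑[ x ∈ pX ] deg pY x + ∑[ x ∈ pX ] deg pZ x + ∑[ y ∈ pY ] deg pZ y
  e≡sumOver-deg tri = begin
    e G                                               ≡⟨ e≡∑∑-oriented G o o-total ⟩
    ∑[ u < n ] ∑[ v < n ] (o u v * A G u v)           ≡⟨ sum-cong-≗ (λ u → sum-cong-≗ (split u)) ⟩
    ∑[ u < n ] ∑[ v < n ] (XY u v + XZ u v + YZ u v)  ≡⟨ ∑∑-distrib-+ (λ u v → XY u v + XZ u v) YZ ⟩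
    ∑∑ (λ u v → XY u v + XZ u v) + ∑∑ YZ              ≡⟨ cong (_+ ∑∑ YZ) (∑∑-distrib-+ XY XZ) ⟩
    ∑∑ XY + ∑∑ XZ + ∑∑ YZ                             ≡⟨ cong₂ _+_ (cong₂ _+_ nested nested) nested ⟨
    ∑[ x ∈ pX ] deg pY x + ∑[ x ∈ pX ] deg pZ x + ∑[ y ∈ pY ] deg pZ y ∎
    where
    open ≡-Reasoning
    ∑∑ : (Fin n → Fin n → ℕ) → ℕ
    ∑∑ F = ∑[ u < n ] ∑[ v < n ] F u v
    nested : ∀ {p q} → ∑[ u ∈ p ] deg q u ≡ ∑∑ (λ u v → χ p u * (χ q v * A G u v))
    nested = sumOver-nested (A G)
    o XY XZ YZ : Fin n → Fin n → ℕ
    o u v = partOrder (part u) (part v)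
    o-total : ∀ u v → adj G u v ≡ true → o u v + o v u ≡ 1
    o-total u v uv = partOrder-total (part u) (part v) (tri u v uv)
    XY u v = χ pX u * (χ pY v * A G u v)
    XZ u v = χ pX u * (χ pZ v * A G u v)
    YZ u v = χ pY u * (χ pZ v * A G u v)
    distrib : ∀ a b c d e → (a * b + a * c + d * c) * e ≡ a * (b * e) + a * (c * e) + d * (c * e)
    distrib = solve-∀
    split : ∀ u v → o u v * A G u v ≡ XY u v + XZ u v + YZ u v
    split u v = distrib (χ pX u) (χ pY v) (χ pZ v) (χ pY u) (A G u v)

  two-common-neighbours⇒C4multi : ∀ {p u v w w'} →
    part u ≢ part v → part u ≢ p → part v ≢ p → part w ≡ p → w ≢ w' →
    adj G u w ≡ true → adj G w v ≡ true → adj G u w' ≡ true → adj G w' v ≡ true →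
    HasC4multi G part
  two-common-neighbours⇒C4multi {u = u} {v} {w} {w'} u≁v u≁p v≁p pw w≢w' uw wv uw' w'v =
    u , w , v , w' ,
    ((adj⇒≢ G uw , u≁v ∘ cong part , adj⇒≢ G uw' , adj⇒≢ G wv , w≢w' , adj⇒≢ G (adj-sym G w'v)) ,
     (uw , wv , adj-sym G w'v , adj-sym G uw')) ,
    map₂ (map₂ inj₁) ∘ distinct-parts-cover (part u) (part w) (part v)
                         (u≁p ∘ λ e → trans e pw) u≁v (v≁p ∘ λ e → trans (sym e) pw)

  common≤1 : ¬ HasC4multi G part → ∀ {p u v} → part u ≢ part v → part u ≢ p → part v ≢ p →
    common p u v ≤ 1
  common≤1 noC4 {p} {u} {v} u≁v u≁p v≁p =
    subst (_≤ 1) (sum-cong-≗ as-count) (count≤1 P unique)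
    where
    P : Fin n → Bool
    P w = does (part w ≟ p) ∧ (adj G u w ∧ adj G w v)
    as-count : ∀ w → b2n (P w) ≡ χ p w * (A G u w * A G w v)
    as-count w = trans (b2n-∧ (does (part w ≟ p)) _) (cong (χ p w *_) (b2n-∧ (adj G u w) (adj G w v)))
    unique : ∀ {w w'} → P w ≡ true → P w' ≡ true → w ≡ w'
    unique {w} {w'} Pw Pw' with w ≟ w'
    ... | yes w≡w' = w≡w'
    ... | no  w≢w' with ∧-≡true (does (part w ≟ p)) Pw | ∧-≡true (does (part w' ≟ p)) Pw'
    ...   | pw , uwv | _ , uw'v with ∧-≡true (adj G u w) uwv | ∧-≡true (adj G u w') uw'v
    ...     | uw , wv | uw' , w'v = ⊥-elim (noC4 (two-common-neighbours⇒C4multi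
                                          u≁v u≁p v≁p (does≡true (part w ≟ p) pw) w≢w' uw wv uw' w'v))

  triangles≡sumOver-Y : ∀ x → triangles x ≡ ∑[ y ∈ pY ] (A G x y * common pZ x y)
  triangles≡sumOver-Y x = sumOver-cong λ y → trans (sumOver-cong (regroup y)) (sumOver-*ˡ (A G x y) _)
    where
    regroup : ∀ y z → A G x y * A G x z * A G y z ≡ A G x y * (A G x z * A G z y)
    regroup y z = trans (*-assoc (A G x y) _ _) (cong (λ a → A G x y * (A G x z * a)) (A-sym G y z))

  triangles≡sumOver-Z : ∀ x → triangles x ≡ ∑[ z ∈ pZ ] (A G x z * common pY x z)
  triangles≡sumOver-Z x = trans (sumOver-comm (λ y z → A G x y * A G x z * A G y z))
    (sumOver-cong λ z → trans (sumOver-cong (λ y → regroup y z)) (sumOver-*ˡ (A G x z) _))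
    where
    regroup : ∀ y z → A G x y * A G x z * A G y z ≡ A G x z * (A G x y * A G y z)
    regroup y z = trans (*-assoc (A G x y) _ _) (x∙yz≈y∙xz (A G x y) (A G x z) (A G y z))

  triangles≤deg-Y : ¬ HasC4multi G part → ∀ {x} → part x ≡ pX → triangles x ≤ deg pY x
  triangles≤deg-Y noC4 {x} px = subst (_≤ deg pY x) (sym (triangles≡sumOver-Y x))
    (sumOver-weighted-≤ (A G x) (common pZ x) (λ y py →
      common≤1 noC4 (parts-≢ px py λ ()) (part-≢ px λ ()) (part-≢ py λ ())))

  triangles≤deg-Z : ¬ HasC4multi G part → ∀ {x} → part x ≡ pX → triangles x ≤ deg pZ x
  triangles≤deg-Z noC4 {x} px = subst (_≤ deg pZ x) (sym (triangles≡sumOver-Z x))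
    (sumOver-weighted-≤ (A G x) (common pY x) (λ z pz →
      common≤1 noC4 (parts-≢ px pz λ ()) (part-≢ px λ ()) (part-≢ pz λ ())))

  triangles≡0 : ¬ HasTriangle G → ∀ x → triangles x ≡ 0
  triangles≡0 noT x = begin
    triangles x                              ≡⟨ sumOver-cong (λ y → sumOver-cong (λ z → no-triangle y z)) ⟩
    ∑[ y ∈ pY ] ∑[ z ∈ pZ ] 0                ≡⟨ sumOver-cong (λ _ → sumOver-const pZ 0) ⟩
    ∑[ y ∈ pY ] (partSize part pZ * 0)       ≡⟨ sumOver-cong (λ _ → *-zeroʳ (partSize part pZ)) ⟩
    ∑[ y ∈ pY ] 0                            ≡⟨ trans (sumOver-const pY 0) (*-zeroʳ (partSize part pY)) ⟩
    0                                        ∎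
    where
    open ≡-Reasoning
    no-triangle : ∀ y z → A G x y * A G x z * A G y z ≡ 0
    no-triangle y z = b2n³≡0 (adj G x y) (adj G x z) (adj G y z) λ xy xz yz →
      noT (x , y , z , (adj⇒≢ G xy , adj⇒≢ G xz , adj⇒≢ G yz) , xy , yz , adj-sym G xz)

  sumOver-common-X : ∑[ y ∈ pY ] ∑[ z ∈ pZ ] common pX y z ≡ ∑[ x ∈ pX ] (deg pY x * deg pZ x)
  sumOver-common-X = begin
    ∑[ y ∈ pY ] ∑[ z ∈ pZ ] ∑[ x ∈ pX ] (A G y x * A G x z)
      ≡⟨ sumOver-rotate (λ y z x → A G y x * A G x z) ⟩
    ∑[ x ∈ pX ] ∑[ y ∈ pY ] ∑[ z ∈ pZ ] (A G y x * A G x z)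
      ≡⟨ sumOver-cong (λ x → sumOver-cong (λ y →
           trans (sumOver-*ˡ (A G y x) (A G x)) (cong (_* deg pZ x) (A-sym G y x)))) ⟩
    ∑[ x ∈ pX ] ∑[ y ∈ pY ] (A G x y * deg pZ x)
      ≡⟨ sumOver-cong (λ x → sumOver-*ʳ (deg pZ x) (A G x)) ⟩
    ∑[ x ∈ pX ] (deg pY x * deg pZ x) ∎
    where open ≡-Reasoning

  sumOver-common-X-edge : ∑[ y ∈ pY ] ∑[ z ∈ pZ ] (common pX y z * A G y z) ≡ ∑[ x ∈ pX ] triangles x
  sumOver-common-X-edge = begin
    ∑[ y ∈ pY ] ∑[ z ∈ pZ ] (common pX y z * A G y z)
      ≡⟨ sumOver-cong (λ y → sumOver-cong (λ z → sumOver-*ʳ (A G y z) (λ x → A G y x * A G x z))) ⟨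
    ∑[ y ∈ pY ] ∑[ z ∈ pZ ] ∑[ x ∈ pX ] (A G y x * A G x z * A G y z)
      ≡⟨ sumOver-rotate (λ y z x → A G y x * A G x z * A G y z) ⟩
    ∑[ x ∈ pX ] ∑[ y ∈ pY ] ∑[ z ∈ pZ ] (A G y x * A G x z * A G y z)
      ≡⟨ sumOver-cong (λ x → sumOver-cong (λ y → sumOver-cong (λ z →
           cong (λ a → a * A G x z * A G y z) (A-sym G y x)))) ⟩
    ∑[ x ∈ pX ] triangles x ∎
    where open ≡-Reasoning

  YZ-pair-count : ¬ HasC4multi G part →
    ∑[ y ∈ pY ] deg pZ y + ∑[ x ∈ pX ] (deg pY x * deg pZ x) ≤
    partSize part pY * partSize part pZ + ∑[ x ∈ pX ] triangles x
  YZ-pair-count noC4 = begin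
    ∑[ y ∈ pY ] deg pZ y + ∑[ x ∈ pX ] (deg pY x * deg pZ x)
      ≡⟨ cong (∑[ y ∈ pY ] deg pZ y +_) sumOver-common-X ⟨
    ∑[ y ∈ pY ] deg pZ y + ∑[ y ∈ pY ] ∑[ z ∈ pZ ] common pX y z
      ≡⟨ double-sumOver-+ (A G) (common pX) ⟨
    ∑[ y ∈ pY ] ∑[ z ∈ pZ ] (A G y z + common pX y z)
      ≤⟨ sumOver-mono (λ y py → sumOver-mono (λ z pz → b2n+≤1+* (adj G y z)
           (common≤1 noC4 (parts-≢ py pz λ ()) (part-≢ py λ ()) (part-≢ pz λ ())))) ⟩
    ∑[ y ∈ pY ] ∑[ z ∈ pZ ] (1 + common pX y z * A G y z)
      ≡⟨ double-sumOver-+ (λ _ _ → 1) (λ y z → common pX y z * A G y z) ⟩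
    ∑[ y ∈ pY ] ∑[ z ∈ pZ ] 1 + ∑[ y ∈ pY ] ∑[ z ∈ pZ ] (common pX y z * A G y z)
      ≡⟨ cong₂ _+_ size sumOver-common-X-edge ⟩
    partSize part pY * partSize part pZ + ∑[ x ∈ pX ] triangles x ∎
    where
    open ≤-Reasoning
    double-sumOver-+ : ∀ (F H : Fin n → Fin n → ℕ) →
      ∑[ y ∈ pY ] ∑[ z ∈ pZ ] (F y z + H y z) ≡
      ∑[ y ∈ pY ] ∑[ z ∈ pZ ] F y z + ∑[ y ∈ pY ] ∑[ z ∈ pZ ] H y z
    double-sumOver-+ F H = trans (sumOver-cong (λ y → sumOver-+ (F y) (H y))) (sumOver-+ _ _)
    size : ∑[ y ∈ pY ] ∑[ z ∈ pZ ] 1 ≡ partSize part pY * partSize part pZ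
    size = trans (sumOver-cong (λ _ → trans (sumOver-const pZ 1) (*-identityʳ _))) (sumOver-const pY _)

  edge-bound : IsTripartite G part → ¬ HasC4multi G part → ∀ c →
    (∀ x → part x ≡ pX → deg pY x + deg pZ x + triangles x ≤ deg pY x * deg pZ x + c) →
    e G ≤ partSize part pY * partSize part pZ + partSize part pX * c
  edge-bound tri noC4 c local =
    subst (_≤ partSize part pY * partSize part pZ + partSize part pX * c) (sym (e≡sumOver-deg tri))
      (+-≤-combine {s = ∑[ x ∈ pX ] deg pY x + ∑[ x ∈ pX ] deg pZ x} (YZ-pair-count noC4) summed)
    where
    summed : ∑[ x ∈ pX ] deg pY x + ∑[ x ∈ pX ] deg pZ x + ∑[ x ∈ pX ] triangles x ≤
             ∑[ x ∈ pX ] (deg pY x * deg pZ x) + partSize part pX * c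
    summed = subst₂ _≤_
      (trans (sumOver-+ _ triangles) (cong (_+ ∑[ x ∈ pX ] triangles x) (sumOver-+ (deg pY) (deg pZ))))
      (trans (sumOver-+ _ (λ _ → c)) (cong (∑[ x ∈ pX ] (deg pY x * deg pZ x) +_) (sumOver-const pX c)))
      (sumOver-mono local)

lemma1 : ∀ {n} (G : Graph n) (part : Fin n → Fin 3) →
    IsTripartite G part →
    (∀ x → part x ≡ pX → HasNbrIn G part x pY × HasNbrIn G part x pZ) →
    (¬ HasC4multi G part →
       e G ≤ partSize part pY * partSize part pZ + 2 * partSize part pX) ×
    (¬ HasTriangle G → ¬ HasC4multi G part →
       e G ≤ partSize part pY * partSize part pZ + partSize part pX)
lemma1 G part tri nbr =
  (λ noC4 → subst (λ k → e G ≤ |Y||Z| + k) (*-comm (partSize part pX) 2)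
     (edge-bound tri noC4 2 λ _ px →
        m+n+o≤m*n+2 (degY≥1 px) (degZ≥1 px) (triangles≤deg-Y noC4 px) (triangles≤deg-Z noC4 px))) ,
  (λ noT noC4 → subst (λ k → e G ≤ |Y||Z| + k) (*-identityʳ (partSize part pX))
     (edge-bound tri noC4 1 λ x px →
        subst (λ t → deg pY x + deg pZ x + t ≤ deg pY x * deg pZ x + 1) (sym (triangles≡0 noT x))
          (subst (_≤ deg pY x * deg pZ x + 1) (sym (+-identityʳ _)) (m+n≤m*n+1 (degY≥1 px) (degZ≥1 px)))))
  where
  open Tripartite G part
  |Y||Z| : ℕ
  |Y||Z| = partSize part pY * partSize part pZ
  degY≥1 : ∀ {x} → part x ≡ pX → 1 ≤ deg pY x
  degY≥1 px = deg≥1 (proj₁ (nbr _ px))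
  degZ≥1 : ∀ {x} → part x ≡ pX → 1 ≤ deg pZ x
  degZ≥1 px = deg≥1 (proj₂ (nbr _ px))
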